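{- Let $X$ be a multigraph (multiple edges allowed) with no isolated vertices. Every arboreal truncation of $X$ is class I.
   Context: Generalized truncation of $X$: for each edge $e=[u,v]$ of $X$ take a new edge (these form a matching $M_F$) whose two ends are labelled $u$ and $v$. For each vertex $v$, the cluster $\mathrm{cl}(v)$ is the set of ends labelled $v$; insert a simple graph $\mathrm{con}(v)$ on $\mathrm{cl}(v)$. The result $M_F\cup\bigcup_v\mathrm{con}(v)$ is a generalized truncation; it is an arboreal truncation if every $\mathrm{con}(v)$ is a forest. A graph is class I if its chromatic index equals its maximum valency. -}

module Defs where

open import Data.Nat using (ℕ; zero; suc; _⊔_; _≤_)
open import Data.Fin using (Fin)
open import Data.Bool using (Bool; true; false)
open import Data.Product using (_×_; _,_; proj₁; proj₂; Σ; ∃; ∃-syntax)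
open import Data.List using (List; []; _∷_; _++_; length; map; foldr; concatMap; filter; allFin; _∷ʳ_)
open import Data.List.Relation.Unary.Linked using (Linked)
open import Data.List.Relation.Unary.Unique.Propositional using (Unique)
open import Relation.Binary.PropositionalEquality using (_≡_)
open import Relation.Nullary using (¬_)

record Multigraph : Set where
  field
    n m    : ℕ
    endpts : Fin m → Fin n × Fin n
    loopless : ∀ e → ¬ (proj₁ (endpts e) ≡ proj₂ (endpts e))

  Vertex : Set
  Vertex = Fin n

  -- ends of the new edges of the matching M_F : edge e gives ends (e,false),(e,true)
  End : Set
  End = Fin m × Bool

  label : End → Vertex
  label (e , false) = proj₁ (endpts e)
  label (e , true)  = proj₂ (endpts e)

  partner : End → End
  partner (e , b) = (e , Data.Bool.not b)

  allEnds : List End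
  allEnds = concatMap (λ e → (e , false) ∷ (e , true) ∷ []) (allFin m)

  NoIsolatedVertices : Set
  NoIsolatedVertices = ∀ (v : Vertex) → ∃[ d ] label d ≡ v

open Multigraph public

-- A choice of con(v) for every v, given as one Bool-valued adjacency on
-- ends; it must be a simple graph (symmetric, irreflexive) and only join
-- ends in the same cluster cl(v) = { d | label d ≡ v }.

record Connection (X : Multigraph) : Set where
  field
    adj       : End X → End X → Bool
    sym       : ∀ d d' → adj d d' ≡ adj d' d
    irrefl    : ∀ d → adj d d ≡ false
    inCluster : ∀ d d' → adj d d' ≡ true → label X d ≡ label X d'

open Connection public

con : {X : Multigraph} → Connection X → Vertex X → End X → End X → Set
con {X} C v d d' = (adj C d d' ≡ true) × (label X d ≡ v) × (label X d' ≡ v)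

HasCycle : {A : Set} → (A → A → Set) → Set
HasCycle {A} R = Σ A λ x → Σ (List A) λ ys →
  (2 ≤ length ys) × Unique (x ∷ ys) × Linked R ((x ∷ ys) ∷ʳ x)

IsForest : {A : Set} → (A → A → Set) → Set
IsForest R = ¬ HasCycle R

Arboreal : {X : Multigraph} → Connection X → Set
Arboreal {X} C = ∀ (v : Vertex X) → IsForest (con C v)

-- The generalized truncation T = M_F ∪ ⋃ con(v), a simple graph on the ends.
-- Its edges are: the matching edges (indexed by Fin m), and the
-- connection edges {d,d'} with adj d d' ≡ true.

module Truncation {X : Multigraph} (C : Connection X) where

  -- valency of an end: one matching edge plus its connection neighbours
  valency : End X → ℕ
  valency d = suc (length (filter (λ d' → Data.Bool._≟_ (adj C d d') true) (allEnds X)))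

  maxValency : ℕ
  maxValency = foldr _⊔_ 0 (map valency (allEnds X))

  record EdgeColouring (k : ℕ) : Set where
    field
      mcol   : Fin (Multigraph.m X) → Fin k
      ccol   : End X → End X → Fin k
      ccol-sym : ∀ d d' → adj C d d' ≡ true → ccol d d' ≡ ccol d' d
      proper-mc : ∀ e b d' → adj C (e , b) d' ≡ true → ¬ (mcol e ≡ ccol (e , b) d')
      proper-cc : ∀ d d₁ d₂ → adj C d d₁ ≡ true → adj C d d₂ ≡ true →
                  ¬ (d₁ ≡ d₂) → ¬ (ccol d d₁ ≡ ccol d d₂)

  ClassI : Set
  ClassI = EdgeColouring maxValency × (∀ k → EdgeColouring k → maxValency ≤ k)

open Truncation public using (ClassI)

module Submission where

-- The connection edges of an arboreal truncation form a forest, since a cycle of them would lie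
-- in a single cluster cl(v), and each end meets at most Δ − 1 of them besides its matching edge.
-- A forest of maximum valency at most D has a proper edge colouring with D colours: remove a leaf
-- d, colour the rest, and give the leaf edge a colour not yet used at the unique neighbour of d,
-- which meets at most D − 1 other edges. One further colour serves the whole matching M_F, so Δ
-- colours suffice, and they are needed at an end of maximum valency.

open import Data.Bool using (Bool; true; false; _∧_; not) renaming (_≟_ to _≟ᵇ_)
open import Data.Fin using (Fin; zero)
import Data.Fin.Properties as Finₚ
open import Data.List using (List; []; _∷_; _++_; _∷ʳ_; length; map; filter; foldr; concatMap; allFin; cartesianProduct)
open import Data.List.Properties using (length-map; length-tabulate; length-++-sucʳ; foldr-preservesᵇ; foldr-preservesᵒ)
open import Data.List.Membership.Propositional using (_∈_; _∉_; find; lose)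
open import Data.List.Membership.Propositional.Properties
  using (∈-∃++; ∈-++⁻; ∈-++⁺ˡ; ∈-++⁺ʳ; ∈-filter⁺; ∈-filter⁻; ∈-map⁺; ∈-map⁻; ∈-allFin; ∈-cartesianProduct⁺)
import Data.List.Membership.DecPropositional as DecMembership
open import Data.List.Relation.Binary.Equality.Propositional using (≋⇒≡)
open import Data.List.Relation.Binary.Subset.Propositional using (_⊆_)
import Data.List.Relation.Binary.Sublist.Propositional as Sublist
import Data.List.Relation.Binary.Sublist.Propositional.Properties as Sublist
open import Data.List.Relation.Unary.All as All using (All; []; _∷_; all?)
import Data.List.Relation.Unary.All.Properties as All
open import Data.List.Relation.Unary.AllPairs using (AllPairs; []; _∷_)
open import Data.List.Relation.Unary.Any using (Any; here; there; any?)
open import Data.List.Relation.Unary.Linked as Linked using (Linked; []; [-]; _∷_)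
open import Data.List.Relation.Unary.Unique.Propositional using (Unique)
open import Data.List.Relation.Unary.Unique.Propositional.Properties using (allFin⁺; cartesianProduct⁺; filter⁺)
open import Data.Nat using (ℕ; zero; suc; _+_; _≤_; _<_; _⊔_; z≤n; s≤s; z<s)
open import Data.Nat.Properties
  using (+-suc; m<m+n; ≤-refl; ≤-trans; ≤-reflexive; ≤-<-trans; <-≤-trans; ≤∧≢⇒<; <⇒≱; n≮0; ⊔-lub; m≤n⇒m≤n⊔o; m≤n⇒m≤o⊔n)
open import Data.Product using (∃; ∃₂; _×_; _,_; proj₁; proj₂)
open import Data.Product.Properties using (≡-dec)
open import Function using (_∘_)
open import Data.Sum using (_⊎_; inj₁; inj₂; [_,_]′; swap)
open import Level using (0ℓ)
open import Relation.Binary.Definitions using (DecidableEquality)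
open import Relation.Binary.PropositionalEquality using (_≡_; _≢_; refl; sym; trans; cong; subst; module ≡-Reasoning)
open import Relation.Nullary using (¬_; Dec; yes; no; does; ¬?; contradiction)
open import Relation.Nullary.Decidable using (_⊎-dec_; decidable-stable)
open import Relation.Unary using (Pred; Decidable)

open import Defs hiding (sym)

module _ {A : Set} where

  Unique-⊆⇒length≤ : {xs ys : List A} → Unique xs → xs ⊆ ys → length xs ≤ length ys
  Unique-⊆⇒length≤ [] _ = z≤n
  Unique-⊆⇒length≤ {x ∷ xs} (x∉xs ∷ xs!) xs⊆ys with ∈-∃++ (xs⊆ys (here refl))
  ... | pre , post , refl =
    ≤-trans (s≤s (Unique-⊆⇒length≤ xs! xs⊆pre++post)) (≤-reflexive (sym (length-++-sucʳ pre x post)))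
    where
    xs⊆pre++post : xs ⊆ pre ++ post
    xs⊆pre++post {y} y∈xs with ∈-++⁻ pre (xs⊆ys (there y∈xs))
    ... | inj₁ y∈pre = ∈-++⁺ˡ y∈pre
    ... | inj₂ (here refl) = contradiction refl (All.lookup x∉xs y∈xs)
    ... | inj₂ (there y∈post) = ∈-++⁺ʳ pre y∈post

  Unique-map⁺ : ∀ {B : Set} {f : A → B} {xs : List A} →
                (∀ {x y} → x ∈ xs → y ∈ xs → x ≢ y → f x ≢ f y) → Unique xs → Unique (map f xs)
  Unique-map⁺ f-inj [] = []
  Unique-map⁺ f-inj (x∉xs ∷ xs!) =
    All.map⁺ (All.tabulate (λ y∈xs → f-inj (here refl) (there y∈xs) (All.lookup x∉xs y∈xs)))
    ∷ Unique-map⁺ (λ x∈ y∈ → f-inj (there x∈) (there y∈)) xs!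

  AllPairs-prefix : ∀ {R : A → A → Set} xs {z ys} → AllPairs R (xs ++ z ∷ ys) → AllPairs R (xs ∷ʳ z)
  AllPairs-prefix [] _ = [] ∷ []
  AllPairs-prefix (x ∷ xs) (Rx ∷ Rxs) =
    All.++⁺ (All.++⁻ˡ xs Rx) (All.head (All.++⁻ʳ xs Rx) ∷ []) ∷ AllPairs-prefix xs Rxs

  Linked-prefix-∷ʳ : ∀ {R : A → A → Set} xs {z ys w} → Linked R (xs ++ z ∷ ys) → R z w → Linked R (xs ∷ʳ z ∷ʳ w)
  Linked-prefix-∷ʳ [] _ Rzw = Rzw ∷ [-]
  Linked-prefix-∷ʳ (x ∷ []) (Rxz ∷ _) Rzw = Rxz ∷ Rzw ∷ [-]
  Linked-prefix-∷ʳ (x ∷ x′ ∷ xs) (Rxx′ ∷ Rxs) Rzw = Rxx′ ∷ Linked-prefix-∷ʳ (x′ ∷ xs) Rxs Rzw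

  path-closing-cycle : ∀ {R : A → A → Set} {y p z rest} →
                       Unique (y ∷ p ∷ rest) → Linked R (y ∷ p ∷ rest) → z ∈ rest → R z y → HasCycle R
  path-closing-cycle {y = y} {p} {z} path! path z∈rest Rzy with ∈-∃++ z∈rest
  ... | q , post , refl =
    y , p ∷ q ∷ʳ z , 2≤ , AllPairs-prefix (y ∷ p ∷ q) path! , Linked-prefix-∷ʳ (y ∷ p ∷ q) path Rzy
    where
    2≤ : 2 ≤ length (p ∷ q ∷ʳ z)
    2≤ = s≤s (≤-trans (s≤s z≤n) (≤-reflexive (sym (length-++-sucʳ q z []))))

  module _ {P Q : Pred A 0ℓ} (P? : Decidable P) (Q? : Decidable Q) (P⇒Q : ∀ {x} → P x → Q x) where

    filter-sublist : ∀ xs → filter P? xs Sublist.⊆ filter Q? xs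
    filter-sublist xs = Sublist.filter⁺ P? Q? (λ { refl → P⇒Q }) (Sublist.⊆-refl {x = xs})

    length-filter-mono : ∀ xs → length (filter P? xs) ≤ length (filter Q? xs)
    length-filter-mono xs = Sublist.length-mono-≤ (filter-sublist xs)

    length-filter-< : ∀ {x xs} → x ∈ xs → Q x → ¬ P x → length (filter P? xs) < length (filter Q? xs)
    length-filter-< {x} {xs} x∈xs Qx ¬Px = ≤∧≢⇒< (length-filter-mono xs) same-length-contradiction
      where
      same-length-contradiction : length (filter P? xs) ≢ length (filter Q? xs)
      same-length-contradiction eq =
        ¬Px (proj₂ (∈-filter⁻ P? {xs = xs} (subst (x ∈_) (sym (≋⇒≡ (Sublist.to-≋ eq (filter-sublist xs))))
                                       (∈-filter⁺ Q? x∈xs Qx))))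

∃-∉-of-length< : ∀ {k} (cs : List (Fin k)) → length cs < k → ∃ λ c → c ∉ cs
∃-∉-of-length< {k} cs cs<k =
  let c , _ , c∉cs = find (decidable-stable (any? (λ c → ¬? (c ∈? cs)) (allFin k)) some-missing) in c , c∉cs
  where
  open DecMembership Finₚ._≟_ using (_∈?_)
  some-missing : ¬ ¬ Any (_∉ cs) (allFin k)
  some-missing none = <⇒≱ cs<k (subst (_≤ length cs) (length-tabulate (λ i → i))
    (Unique-⊆⇒length≤ (allFin⁺ k) (λ {c} _ → decidable-stable (c ∈? cs) (none ∘ lose (∈-allFin c)))))

≤-foldr-⊔ : ∀ {n} {ns : List ℕ} → n ∈ ns → n ≤ foldr _⊔_ 0 ns
≤-foldr-⊔ n∈ns = foldr-preservesᵒ (λ x y → [ m≤n⇒m≤n⊔o y , m≤n⇒m≤o⊔n x ]′) 0 _ (inj₂ (lose n∈ns ≤-refl))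

foldr-⊔-lub : ∀ {k} {ns : List ℕ} → All (_≤ k) ns → foldr _⊔_ 0 ns ≤ k
foldr-⊔-lub = foldr-preservesᵇ ⊔-lub z≤n

module FiniteGraph {A : Set} (_≟_ : DecidableEquality A) (vertices : List A) (∈-vertices : ∀ x → x ∈ vertices) where

  record Graph : Set where
    field
      adj        : A → A → Bool
      adj-sym    : ∀ x y → adj x y ≡ adj y x
      adj-irrefl : ∀ x → adj x x ≡ false

  open Graph public

  module _ (G : Graph) where

    Edge : A → A → Set
    Edge x y = adj G x y ≡ true

    Edge-sym : ∀ {x y} → Edge x y → Edge y x
    Edge-sym {x} {y} x~y = trans (adj-sym G y x) x~y

    Edge⇒≢ : ∀ {x y} → Edge x y → x ≢ y
    Edge⇒≢ {x} x~x refl with () ← trans (sym x~x) (adj-irrefl G x)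

    Acyclic : Set
    Acyclic = ¬ HasCycle Edge

    IsLeaf : A → A → Set
    IsLeaf d d′ = Edge d d′ × (∀ {y} → Edge d y → y ≡ d′)

    neighbours : A → List A
    neighbours x = filter (λ y → adj G x y ≟ᵇ true) vertices

    degree : A → ℕ
    degree x = length (neighbours x)

    ∈-neighbours⁺ : ∀ {x y} → Edge x y → y ∈ neighbours x
    ∈-neighbours⁺ {x} {y} = ∈-filter⁺ (λ y → adj G x y ≟ᵇ true) (∈-vertices y)

    ∈-neighbours⁻ : ∀ {x y} → y ∈ neighbours x → Edge x y
    ∈-neighbours⁻ {x} = proj₂ ∘ ∈-filter⁻ (λ y → adj G x y ≟ᵇ true) {xs = vertices}

    adjacentPairs : List (A × A)
    adjacentPairs = filter (λ (x , y) → adj G x y ≟ᵇ true) (cartesianProduct vertices vertices)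

    edge? : (∃₂ Edge) ⊎ (∀ {x y} → ¬ Edge x y)
    edge? with any? (λ (x , y) → adj G x y ≟ᵇ true) (cartesianProduct vertices vertices)
    ... | yes some = let (x , y) , _ , x~y = find some in inj₁ (x , y , x~y)
    ... | no none = inj₂ (λ {x} {y} x~y → none (lose (∈-cartesianProduct⁺ (∈-vertices x) (∈-vertices y)) x~y))

  _∖_ : Graph → A → Graph
  G ∖ d = record { adj = adj′ ; adj-sym = adj′-sym ; adj-irrefl = adj′-irrefl }
    where
    adj′ : A → A → Bool
    adj′ x y = not (does (x ≟ d)) ∧ not (does (y ≟ d)) ∧ adj G x y
    adj′-sym : ∀ x y → adj′ x y ≡ adj′ y x
    adj′-sym x y with x ≟ d | y ≟ d
    ... | yes _ | yes _ = refl
    ... | yes _ | no _  = refl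
    ... | no _  | yes _ = refl
    ... | no _  | no _  = adj-sym G x y
    adj′-irrefl : ∀ x → adj′ x x ≡ false
    adj′-irrefl x with x ≟ d
    ... | yes _ = refl
    ... | no _  = adj-irrefl G x

  module _ (G : Graph) {d : A} where

    ∖-Edge⁻ : ∀ {x y} → Edge (G ∖ d) x y → Edge G x y × x ≢ d × y ≢ d
    ∖-Edge⁻ {x} {y} e with x ≟ d | y ≟ d
    ∖-Edge⁻ () | yes _ | _
    ∖-Edge⁻ () | no _ | yes _
    ∖-Edge⁻ e | no x≢d | no y≢d = e , x≢d , y≢d

    ∖-Edge⁺ : ∀ {x y} → Edge G x y → x ≢ d → y ≢ d → Edge (G ∖ d) x y
    ∖-Edge⁺ {x} {y} e x≢d y≢d with x ≟ d | y ≟ d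
    ... | yes x≡d | _ = contradiction x≡d x≢d
    ... | no _ | yes y≡d = contradiction y≡d y≢d
    ... | no _ | no _ = e

    ∖-Acyclic : Acyclic G → Acyclic (G ∖ d)
    ∖-Acyclic acyclic (x , ys , 2≤ , cycle! , cycle) =
      acyclic (x , ys , 2≤ , cycle! , Linked.map (proj₁ ∘ ∖-Edge⁻) cycle)

    ∖-degree≤ : ∀ x → degree (G ∖ d) x ≤ degree G x
    ∖-degree≤ x = length-filter-mono (λ y → adj (G ∖ d) x y ≟ᵇ true) (λ y → adj G x y ≟ᵇ true)
                    (proj₁ ∘ ∖-Edge⁻) vertices

    ∖-degree< : ∀ {x} → Edge G x d → degree (G ∖ d) x < degree G x
    ∖-degree< {x} x~d = length-filter-< (λ y → adj (G ∖ d) x y ≟ᵇ true) (λ y → adj G x y ≟ᵇ true)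
                          (proj₁ ∘ ∖-Edge⁻) (∈-vertices d) x~d (λ e → proj₂ (proj₂ (∖-Edge⁻ e)) refl)

    ∖-adjacentPairs< : ∀ {d′} → Edge G d d′ → length (adjacentPairs (G ∖ d)) < length (adjacentPairs G)
    ∖-adjacentPairs< {d′} d~d′ =
      length-filter-< (λ (x , y) → adj (G ∖ d) x y ≟ᵇ true) (λ (x , y) → adj G x y ≟ᵇ true)
        (proj₁ ∘ ∖-Edge⁻) (∈-cartesianProduct⁺ (∈-vertices d) (∈-vertices d′)) d~d′
        (λ e → proj₁ (proj₂ (∖-Edge⁻ e)) refl)

  module _ (G : Graph) (acyclic : Acyclic G) where

    leaf-or-extension : ∀ {y p rest} → Unique (y ∷ p ∷ rest) → Linked (Edge G) (y ∷ p ∷ rest) →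
                        IsLeaf G y p ⊎ ∃ λ z → z ∉ y ∷ p ∷ rest × Edge G z y
    leaf-or-extension {y} {p} {rest} path! path@(y~p ∷ _) with all? (_≟ p) (neighbours G y)
    ... | yes all≡p = inj₁ (y~p , λ y~z → All.lookup all≡p (∈-neighbours⁺ G y~z))
    ... | no ¬all≡p = let z , z∈ , z≢p = find (All.¬All⇒Any¬ (_≟ p) _ ¬all≡p) in
                      extend (∈-neighbours⁻ G z∈) z≢p
      where
      open DecMembership _≟_ using (_∈?_)
      extend : ∀ {z} → Edge G y z → z ≢ p → IsLeaf G y p ⊎ ∃ λ z → z ∉ y ∷ p ∷ rest × Edge G z y
      extend {z} y~z z≢p with z ∈? (y ∷ p ∷ rest)
      ... | no z∉path = inj₂ (z , z∉path , Edge-sym G y~z)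
      ... | yes (here z≡y) = contradiction (sym z≡y) (Edge⇒≢ G y~z)
      ... | yes (there (here z≡p)) = contradiction z≡p z≢p
      ... | yes (there (there z∈rest)) =
        contradiction (path-closing-cycle path! path z∈rest (Edge-sym G y~z)) acyclic

    ∃-leaf-extending-path : ∀ fuel {y p rest} → length vertices < fuel + length (y ∷ p ∷ rest) →
                       Unique (y ∷ p ∷ rest) → Linked (Edge G) (y ∷ p ∷ rest) → ∃₂ (IsLeaf G)
    ∃-leaf-extending-path zero bound path! _ =
      contradiction (Unique-⊆⇒length≤ path! (λ {x} _ → ∈-vertices x)) (<⇒≱ bound)
    ∃-leaf-extending-path (suc fuel) {y} {p} {rest} bound path! path with leaf-or-extension path! path
    ... | inj₁ leaf = y , p , leaf
    ... | inj₂ (z , z∉path , z~y) =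
      ∃-leaf-extending-path fuel (subst (length vertices <_) (sym (+-suc fuel _)) bound)
        (All.¬Any⇒All¬ _ z∉path ∷ path!) (z~y ∷ path)

    ∃-leaf : ∀ {x y} → Edge G x y → ∃₂ (IsLeaf G)
    ∃-leaf {x} {y} x~y = ∃-leaf-extending-path (length vertices) (m<m+n (length vertices) z<s)
                         (((Edge⇒≢ G x~y ∘ sym) ∷ []) ∷ [] ∷ []) (Edge-sym G x~y ∷ [-])

  record EdgeColouringAvoiding (G : Graph) {k : ℕ} (c₀ : Fin k) : Set where
    field
      colour        : A → A → Fin k
      colour-sym    : ∀ {x y} → Edge G x y → colour x y ≡ colour y x
      colour-≢c₀    : ∀ {x y} → Edge G x y → colour x y ≢ c₀
      colour-proper : ∀ {x y z} → Edge G x y → Edge G x z → y ≢ z → colour x y ≢ colour x z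

  open EdgeColouringAvoiding public

  edgeless-colouring : ∀ {G k} {c₀ : Fin k} → (∀ {x y} → ¬ Edge G x y) → EdgeColouringAvoiding G c₀
  edgeless-colouring {c₀ = c₀} none = record
    { colour = λ _ _ → c₀
    ; colour-sym = λ x~y → contradiction x~y none
    ; colour-≢c₀ = λ x~y → contradiction x~y none
    ; colour-proper = λ x~y → contradiction x~y none
    }

  module LeafExtension {G : Graph} {d d′ : A} (leaf : IsLeaf G d d′) {k} {c₀ : Fin k}
    (κ : EdgeColouringAvoiding (G ∖ d) c₀) (c : Fin k) (c≢c₀ : c ≢ c₀)
    (c-fresh : ∀ {y} → Edge (G ∖ d) d′ y → c ≢ colour κ d′ y) where

    touches? : ∀ x y → Dec (x ≡ d ⊎ y ≡ d)
    touches? x y = x ≟ d ⊎-dec y ≟ d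

    extended : A → A → Fin k
    extended x y with touches? x y
    ... | yes _ = c
    ... | no _  = colour κ x y

    extended-touching : ∀ {x y} → x ≡ d ⊎ y ≡ d → extended x y ≡ c
    extended-touching {x} {y} t with touches? x y
    ... | yes _ = refl
    ... | no ¬t = contradiction t ¬t

    extended-away : ∀ {x y} → ¬ (x ≡ d ⊎ y ≡ d) → extended x y ≡ colour κ x y
    extended-away {x} {y} ¬t with touches? x y
    ... | yes t = contradiction t ¬t
    ... | no _ = refl

    away-Edge : ∀ {x y} → Edge G x y → ¬ (x ≡ d ⊎ y ≡ d) → Edge (G ∖ d) x y
    away-Edge x~y ¬t = ∖-Edge⁺ G x~y (¬t ∘ inj₁) (¬t ∘ inj₂)

    extended-sym : ∀ {x y} → Edge G x y → extended x y ≡ extended y x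
    extended-sym {x} {y} x~y with touches? x y
    ... | yes t = sym (extended-touching (swap t))
    ... | no ¬t = trans (colour-sym κ (away-Edge x~y ¬t)) (sym (extended-away (¬t ∘ swap)))

    extended-≢c₀ : ∀ {x y} → Edge G x y → extended x y ≢ c₀
    extended-≢c₀ {x} {y} x~y with touches? x y
    ... | yes _ = c≢c₀
    ... | no ¬t = colour-≢c₀ κ (away-Edge x~y ¬t)

    d′≢d : d′ ≢ d
    d′≢d = Edge⇒≢ G (Edge-sym G (proj₁ leaf))

    leaf-edge-vs-other : ∀ {x y z} → Edge G x y → Edge G x z → y ≡ d → z ≢ d → extended x y ≢ extended x z
    leaf-edge-vs-other x~d x~z refl z≢d with proj₂ leaf (Edge-sym G x~d)
    ... | refl = λ eq → c-fresh (∖-Edge⁺ G x~z d′≢d z≢d) (begin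
      c                ≡⟨ extended-touching (inj₂ refl) ⟨
      extended d′ d    ≡⟨ eq ⟩
      extended d′ _    ≡⟨ extended-away [ d′≢d , z≢d ]′ ⟩
      colour κ d′ _    ∎)
      where open ≡-Reasoning

    extended-proper : ∀ {x y z} → Edge G x y → Edge G x z → y ≢ z → extended x y ≢ extended x z
    extended-proper {x} {y} {z} x~y x~z y≢z = cases (x ≟ d) (y ≟ d) (z ≟ d)
      where
      cases : Dec (x ≡ d) → Dec (y ≡ d) → Dec (z ≡ d) → extended x y ≢ extended x z
      cases (yes refl) _ _ = contradiction (trans (proj₂ leaf x~y) (sym (proj₂ leaf x~z))) y≢z
      cases (no _) (yes y≡d) (yes z≡d) = contradiction (trans y≡d (sym z≡d)) y≢z
      cases (no _) (yes y≡d) (no z≢d) = leaf-edge-vs-other x~y x~z y≡d z≢d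
      cases (no _) (no y≢d) (yes z≡d) = leaf-edge-vs-other x~z x~y z≡d y≢d ∘ sym
      cases (no x≢d) (no y≢d) (no z≢d) eq =
        colour-proper κ (∖-Edge⁺ G x~y x≢d y≢d) (∖-Edge⁺ G x~z x≢d z≢d) y≢z
          (trans (sym (extended-away [ x≢d , y≢d ]′)) (trans eq (extended-away [ x≢d , z≢d ]′)))

    colouring : EdgeColouringAvoiding G c₀
    colouring = record
      { colour = extended ; colour-sym = extended-sym ; colour-≢c₀ = extended-≢c₀ ; colour-proper = extended-proper }

  colouring-by-leaf-removal : ∀ fuel {k} (c₀ : Fin k) (G : Graph) → length (adjacentPairs G) < fuel →
                              Acyclic G → (∀ x → degree G x < k) → EdgeColouringAvoiding G c₀
  colouring-by-leaf-removal (suc fuel) c₀ G (s≤s size≤fuel) acyclic degree<k with edge? G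
  ... | inj₂ none = edgeless-colouring none
  ... | inj₁ (_ , _ , x~y) with ∃-leaf G acyclic x~y
  ... | d , d′ , isLeaf@(d~d′ , _) =
    LeafExtension.colouring isLeaf κ c (c∉used ∘ here) (λ e → c∉used ∘ there ∘ used-at-d′ e)
    where
    κ : EdgeColouringAvoiding (G ∖ d) c₀
    κ = colouring-by-leaf-removal fuel c₀ (G ∖ d) (<-≤-trans (∖-adjacentPairs< G d~d′) size≤fuel)
          (∖-Acyclic G acyclic) (λ x → ≤-<-trans (∖-degree≤ G x) (degree<k x))
    used : List (Fin _)
    used = c₀ ∷ map (colour κ d′) (neighbours (G ∖ d) d′)
    used-at-d′ : ∀ {y c} → Edge (G ∖ d) d′ y → c ≡ colour κ d′ y →
                 c ∈ map (colour κ d′) (neighbours (G ∖ d) d′)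
    used-at-d′ e refl = ∈-map⁺ (colour κ d′) (∈-neighbours⁺ (G ∖ d) e)
    few-used : length used < _
    few-used = subst (λ n → suc n < _) (sym (length-map (colour κ d′) (neighbours (G ∖ d) d′)))
                 (≤-trans (s≤s (∖-degree< G (Edge-sym G d~d′))) (degree<k d′))
    c = proj₁ (∃-∉-of-length< used few-used)
    c∉used = proj₂ (∃-∉-of-length< used few-used)

  acyclic-colouring : ∀ {k} (c₀ : Fin k) (G : Graph) → Acyclic G → (∀ x → degree G x < k) →
                      EdgeColouringAvoiding G c₀
  acyclic-colouring c₀ G = colouring-by-leaf-removal (suc (length (adjacentPairs G))) c₀ G ≤-refl

allEnds-as-product : ∀ {B : Set} (es : List B) →
                     concatMap (λ e → (e , false) ∷ (e , true) ∷ []) es ≡ cartesianProduct es (false ∷ true ∷ [])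
allEnds-as-product [] = refl
allEnds-as-product (e ∷ es) = cong (λ ends → (e , false) ∷ (e , true) ∷ ends) (allEnds-as-product es)

module _ (X : Multigraph) where

  Unique-allEnds : Unique (allEnds X)
  Unique-allEnds = subst Unique (sym (allEnds-as-product (allFin _)))
                     (cartesianProduct⁺ (allFin⁺ _) (((λ ()) ∷ []) ∷ [] ∷ []))

  ∈-allEnds : ∀ d → d ∈ allEnds X
  ∈-allEnds (e , b) =
    subst (_ ∈_) (sym (allEnds-as-product (allFin _))) (∈-cartesianProduct⁺ (∈-allFin e) (∈-bools b))
    where
    ∈-bools : ∀ b → b ∈ false ∷ true ∷ []
    ∈-bools false = here refl
    ∈-bools true  = there (here refl)

module _ {X : Multigraph} (C : Connection X) where

  open Truncation C
  open FiniteGraph (≡-dec Finₚ._≟_ _≟ᵇ_) (allEnds X) (∈-allEnds X)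

  connectionGraph : Graph
  connectionGraph = record { adj = adj C ; adj-sym = Connection.sym C ; adj-irrefl = irrefl C }

  arboreal⇒acyclic : Arboreal C → Acyclic connectionGraph
  arboreal⇒acyclic arboreal (x , ys , 2≤ , cycle! , cycle) =
    arboreal (label X x) (x , ys , 2≤ , cycle! , within-cluster (ys ∷ʳ x) refl cycle)
    where
    within-cluster : ∀ {v z} zs → label X z ≡ v → Linked (Edge connectionGraph) (z ∷ zs) → Linked (con C v) (z ∷ zs)
    within-cluster [] _ [-] = [-]
    within-cluster (z′ ∷ zs) z∈v (z~z′ ∷ path) = (z~z′ , z∈v , z′∈v) ∷ within-cluster zs z′∈v path
      where z′∈v = trans (sym (inCluster C _ _ z~z′)) z∈v

  truncation-colouring : ∀ k → Acyclic connectionGraph → (∀ d → valency d ≤ k) → EdgeColouring k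
  truncation-colouring zero _ valency≤0 = record
    { mcol = λ e → no-end (e , false) ; ccol = λ d → no-end d ; ccol-sym = λ d → no-end d
    ; proper-mc = λ e → no-end (e , false) ; proper-cc = λ d → no-end d }
    where
    no-end : ∀ {P : Set} → End X → P
    no-end d = contradiction (valency≤0 d) n≮0
  truncation-colouring (suc k) acyclic valency≤ = record
    { mcol = λ _ → zero ; ccol = colour κ ; ccol-sym = λ _ _ → colour-sym κ
    ; proper-mc = λ _ _ _ e → colour-≢c₀ κ e ∘ sym ; proper-cc = λ _ _ _ → colour-proper κ }
    where
    κ : EdgeColouringAvoiding connectionGraph zero
    κ = acyclic-colouring zero connectionGraph acyclic valency≤

  valency≤colours : ∀ {k} → EdgeColouring k → ∀ d → valency d ≤ k
  valency≤colours {k} κ (e , b) =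
    subst (_≤ k) (cong suc (length-map (ccol (e , b)) at-end))
      (subst (length colours ≤_) (length-tabulate (λ i → i)) (Unique-⊆⇒length≤ colours! (λ {c} _ → ∈-allFin c)))
    where
    open EdgeColouring κ
    at-end = neighbours connectionGraph (e , b)
    colours = mcol e ∷ map (ccol (e , b)) at-end
    mcol∉ : All (mcol e ≢_) (map (ccol (e , b)) at-end)
    mcol∉ = All.tabulate λ c∈ → let y , y∈ , c≡ = ∈-map⁻ (ccol (e , b)) c∈ in
                                λ mcol≡c → proper-mc e b y (∈-neighbours⁻ connectionGraph y∈) (trans mcol≡c c≡)
    colours! : Unique colours
    colours! = mcol∉ ∷ Unique-map⁺
      (λ y∈ z∈ → proper-cc (e , b) _ _ (∈-neighbours⁻ connectionGraph y∈) (∈-neighbours⁻ connectionGraph z∈))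
      (filter⁺ (λ y → adj C (e , b) y ≟ᵇ true) (Unique-allEnds X))

  valency≤maxValency : ∀ d → valency d ≤ maxValency
  valency≤maxValency d = ≤-foldr-⊔ (∈-map⁺ valency (∈-allEnds X d))

  maxValency-least : ∀ {k} → (∀ d → valency d ≤ k) → maxValency ≤ k
  maxValency-least valency≤k = foldr-⊔-lub (All.map⁺ {xs = allEnds X} (All.tabulate λ {d} _ → valency≤k d))

corollary6p2 : (X : Multigraph) → NoIsolatedVertices X →
    (C : Connection X) → Arboreal C → ClassI C
corollary6p2 X _ C arboreal =
  truncation-colouring C maxValency (arboreal⇒acyclic C arboreal) (valency≤maxValency C) ,
  λ k κ → maxValency-least C (valency≤colours C κ)
  where open Truncation C using (maxValency)
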